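{- Let $n$ be a natural number and let $(a_1,a_2,\dots,a_m)$ be a tuple obtained from the one-term tuple $(n)$ by a non-ascending sequence of jumps. Then the sequence $a_2,a_3,\dots,a_m,a_1$ is non-decreasing.
   Context: Partitions are written as finite ordered tuples of positive integers (the "terms"). For an integer $r\ge 1$, a jump of order $r$ transforms a tuple $(a_1,a_2,\dots,a_m)$ with $a_1>r$ into $(a_1-r,\,r,\,a_2,\dots,a_m)$; it is allowed only when the new first term $a_1-r$ is not less than the last term of the resulting tuple (which is $a_m$ if $m\ge 2$, and $r$ if $m=1$), and $r$ is not greater than any of the terms $a_2,\dots,a_m$ to its right. A non-ascending sequence of jumps is a finite sequence of successively applied jumps whose orders never increase (they stay the same or decrease). -}

module Defs where

open import Data.Nat using (ℕ; _≤_; _<_; _≥_)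
open import Data.List using (List; []; _∷_; _++_; [_])
open import Data.List.Relation.Unary.All using (All)
open import Data.List.Relation.Unary.Linked using (Linked)
open import Data.Nat using (_∸_)

-- last term of the tuple obtained after a jump of order r on a₁ ∷ rest:
-- it is the last element of rest if rest is nonempty, and r otherwise.
lastAfter : ℕ → List ℕ → ℕ
lastAfter r [] = r
lastAfter r (x ∷ []) = x
lastAfter r (x ∷ y ∷ ys) = lastAfter r (y ∷ ys)

data Jump (r : ℕ) : List ℕ → List ℕ → Set where
  jump : ∀ {a₁ rest} →
         1 ≤ r →
         r < a₁ →
         lastAfter r rest ≤ a₁ ∸ r →
         All (r ≤_) rest →
         Jump r (a₁ ∷ rest) ((a₁ ∸ r) ∷ r ∷ rest)

data Jumps : List ℕ → List ℕ → List ℕ → Set where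
  done : ∀ {t} → Jumps [] t t
  step : ∀ {r rs t t' t''} → Jump r t t' → Jumps rs t' t'' → Jumps (r ∷ rs) t t''

NonAscending : List ℕ → Set
NonAscending = Linked (λ x y → y ≤ x)

NonDecreasing : List ℕ → Set
NonDecreasing = Linked _≤_

{-# OPTIONS --safe #-}
module Submission where

-- Jumps keep the rotated tuple a₂ … aₘ a₁ sorted, and (n) trivially is. A jump of
-- order r turns it into r a₂ … aₘ (a₁ − r); the front stays sorted because
-- r ≤ a₂, …, aₘ, and the back because aₘ ≤ a₁ − r.

open import Defs
open import Data.Nat using (ℕ; _≤_)
open import Data.List using (List; []; _∷_; _++_; [_])
open import Data.List.Relation.Unary.All using (_∷_)
open import Data.List.Relation.Unary.Linked using (Linked; [-]; _∷_)
open import Relation.Binary.PropositionalEquality using (_≡_; refl; trans; sym; subst)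

lastAfter-∷ : ∀ r x xs → lastAfter r (x ∷ xs) ≡ lastAfter x xs
lastAfter-∷ r x []       = refl
lastAfter-∷ r x (y ∷ ys) = trans (lastAfter-∷ r y ys) (sym (lastAfter-∷ x y ys))

Linked-replaceLast : ∀ {R : ℕ → ℕ → Set} x xs {a b} →
                     Linked R (x ∷ xs ++ [ a ]) → R (lastAfter x xs) b →
                     Linked R (x ∷ xs ++ [ b ])
Linked-replaceLast     x []       _           xRb = xRb ∷ [-]
Linked-replaceLast {R} x (y ∷ ys) (xRy ∷ ys↗) R-b =
  xRy ∷ Linked-replaceLast y ys ys↗ (subst (λ z → R z _) (lastAfter-∷ x y ys) R-b)

moveHeadToEnd : List ℕ → List ℕ
moveHeadToEnd []         = []
moveHeadToEnd (a ∷ rest) = rest ++ [ a ]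

Jump-preserves-sorted : ∀ {r t t'} → Jump r t t' →
                        NonDecreasing (moveHeadToEnd t) → NonDecreasing (moveHeadToEnd t')
Jump-preserves-sorted (jump {rest = []}     _ _ last≤ _)          _      = last≤ ∷ [-]
Jump-preserves-sorted (jump {rest = x ∷ xs} _ _ last≤ (r≤x ∷ _)) sorted =
  r≤x ∷ Linked-replaceLast x xs sorted (subst (_≤ _) (lastAfter-∷ _ x xs) last≤)

Jumps-preserve-sorted : ∀ {rs t t'} → Jumps rs t t' →
                        NonDecreasing (moveHeadToEnd t) → NonDecreasing (moveHeadToEnd t')
Jumps-preserve-sorted done        sorted = sorted
Jumps-preserve-sorted (step j js) sorted =
  Jumps-preserve-sorted js (Jump-preserves-sorted j sorted)

mainTheorem2 : (n : ℕ) (rs : List ℕ) (a₁ : ℕ) (rest : List ℕ) →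
               NonAscending rs →
               Jumps rs [ n ] (a₁ ∷ rest) →
               NonDecreasing (rest ++ [ a₁ ])
mainTheorem2 n rs a₁ rest _ js = Jumps-preserve-sorted js [-]
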